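{- Let $w\in S_n$ and $c\in\{1,\dots,n\}$. Then $$\mathrm{rajcode}(w^{ -1})_{c+1}-\max\big(\mathrm{movecode}(w)_{c+1}-1,0\big)=d_c(w)=\mathrm{rajcode}(w^{ -1})_c-\mathrm{movecode}(w)_c.$$
   Context: A diagram is a finite subset of $\mathbb{Z}_{>0}\times\mathbb{Z}_{>0}$; $(r,c)$ is the cell in row $r$ (row 1 on top), column $c$. Weak compositions are sequences of nonnegative integers with finitely many nonzero entries; $\alpha_i$ denotes the $i$-th entry. For $v\in S_m$: $\mathrm{Rothe}(v)=\{(i,v(j)) : i<j,\ v(i)>v(j)\}$. For a diagram $D$, $\mathrm{dark}(D)$ is computed by scanning rows from bottom to top: for row $r$, if there is $(r,c)\in D$ such that $\mathrm{dark}(D)$ currently has no cell in column $c$, take the largest such $c$ and add $(r,c)$; its cells are called dark clouds. The snow diagram of $v$ is obtained from $\mathrm{Rothe}(v)$ by adding, for each $(r,c)\in\mathrm{dark}(\mathrm{Rothe}(v))$, every cell $(r',c)$ with $r'<r$ not in $\mathrm{Rothe}(v)$; $\mathrm{rajcode}(v)$ is the weak composition whose $i$-th entry is the number of cells in row $i$ of the snow diagram. $d_c(w)$ is the number of cells of $\mathrm{dark}(\mathrm{Rothe}(w))$ in columns strictly greater than $c$. $\mathrm{movecode}(w)$ is the weak composition whose $i$-th entry is the number of cells $(r,i)\in\mathrm{Rothe}(w)$ such that there is no cell $(r,j)\in\mathrm{dark}(\mathrm{Rothe}(w))$ with $j>i$. -}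

module Defs where

open import Data.Nat using (ℕ; zero; suc; _<ᵇ_; _≡ᵇ_; _∸_)
open import Data.Bool using (Bool; true; false; _∧_; _∨_; not; if_then_else_)
open import Data.List using (List; []; _∷_; foldl; length; map)
open import Data.Bool.ListAction using (any)
open import Data.List.Base using (upTo)
open import Data.Maybe using (Maybe; just; nothing)
open import Data.Product using (_×_; _,_; proj₁; proj₂)
open import Data.Fin using (Fin; toℕ)
open import Data.Fin.Permutation using (Permutation′; _⟨$⟩ʳ_; _⟨$⟩ˡ_)

-- Conventions: rows, columns and permutation positions are 1-based natural
-- numbers.  A permutation of S_n is viewed as a function on {1,..,n}
-- (values outside {1,..,n} are irrelevant and never used).

range : ℕ → List ℕ
range n = map suc (upTo n)

toFin : (n i : ℕ) → Maybe (Fin n)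
toFin zero    _             = nothing
toFin (suc n) zero          = nothing
toFin (suc n) (suc zero)    = just Fin.zero
toFin (suc n) (suc (suc i)) with toFin n (suc i)
... | just k  = just (Fin.suc k)
... | nothing = nothing

permFun : ∀ {n} → Permutation′ n → ℕ → ℕ
permFun {n} π i with toFin n i
... | just k  = suc (toℕ (π ⟨$⟩ʳ k))
... | nothing = i

permInvFun : ∀ {n} → Permutation′ n → ℕ → ℕ
permInvFun {n} π i with toFin n i
... | just k  = suc (toℕ (π ⟨$⟩ˡ k))
... | nothing = i

-- A diagram inside [1..n]×[1..n], given by a decidable membership test
-- (mem r c = true iff (r,c) is a cell).
Diagram : Set
Diagram = ℕ → ℕ → Bool

-- Rothe(v) for v ∈ S_n:  {(i, v j) : i < j, v i > v j}
rothe : ℕ → (ℕ → ℕ) → Diagram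
rothe n v r c =
  any (λ i → (i ≡ᵇ r) ∧
        any (λ j → (i <ᵇ j) ∧ (v j <ᵇ v i) ∧ (v j ≡ᵇ c)) (range n))
      (range n)

largest : ℕ → (ℕ → Bool) → Maybe ℕ
largest zero    p = nothing
largest (suc k) p = if p (suc k) then just (suc k) else largest k p

colUsed : List (ℕ × ℕ) → ℕ → Bool
colUsed cells c = any (λ x → proj₂ x ≡ᵇ c) cells

darkStep : ℕ → Diagram → List (ℕ × ℕ) → ℕ → List (ℕ × ℕ)
darkStep n D acc r with largest n (λ c → D r c ∧ not (colUsed acc c))
... | just c  = (r , c) ∷ acc
... | nothing = acc

rowsBottomUp : ℕ → List ℕ
rowsBottomUp zero    = []
rowsBottomUp (suc n) = suc n ∷ rowsBottomUp n

dark : ℕ → Diagram → List (ℕ × ℕ)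
dark n D = foldl (darkStep n D) [] (rowsBottomUp n)

inDark : List (ℕ × ℕ) → ℕ → ℕ → Bool
inDark cells r c = any (λ x → (proj₁ x ≡ᵇ r) ∧ (proj₂ x ≡ᵇ c)) cells

-- snow diagram of v ∈ S_n: Rothe(v) plus, for each dark cloud (r,c),
-- all cells (r',c) with r' < r
snow : ℕ → (ℕ → ℕ) → Diagram
snow n v r' c =
  rothe n v r' c ∨
  any (λ x → (proj₂ x ≡ᵇ c) ∧ (r' <ᵇ proj₁ x)) (dark n (rothe n v))

count : {A : Set} → (A → Bool) → List A → ℕ
count p []       = 0
count p (x ∷ xs) = if p x then suc (count p xs) else count p xs

rajcode : ℕ → (ℕ → ℕ) → ℕ → ℕ
rajcode n v i = if (0 <ᵇ i) then count (λ c → snow n v i c) (range n) else 0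

dcount : ∀ {n} → Permutation′ n → ℕ → ℕ
dcount {n} w c =
  count (λ x → c <ᵇ proj₂ x) (dark n (rothe n (permFun w)))

movecode : ∀ {n} → Permutation′ n → ℕ → ℕ
movecode {n} w i =
  count (λ r → rothe n (permFun w) r i ∧
               not (any (λ x → (proj₁ x ≡ᵇ r) ∧ (i <ᵇ proj₂ x))
                        (dark n (rothe n (permFun w)))))
        (range n)

rajcodeInv : ∀ {n} → Permutation′ n → ℕ → ℕ
rajcodeInv {n} w = rajcode n (permInvFun w)

-- The scan defining dark(D) produces the unique set of cells of D with at most one
-- cell in each row and column such that every other cell of D has one of them to
-- its right in its row or below it in its column.  This characterisation is
-- symmetric under transposition and Rothe(w⁻¹) is the transpose of Rothe(w), so
-- the dark clouds of Rothe(w⁻¹) are the transposed dark clouds of Rothe(w).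
-- Row i of the snow diagram of w⁻¹ therefore consists of the transposes of the
-- cells of column i of Rothe(w) with no cloud to their right, counted by
-- movecode(w)ᵢ, and one cell per cloud of Rothe(w) in a column > i, counted by
-- dᵢ(w): rajcode(w⁻¹)ᵢ = movecode(w)ᵢ + dᵢ(w).  Finally d_c = d_{c+1} + [column c+1
-- holds a cloud], and column c+1 holds a cloud iff movecode(w)_{c+1} > 0: the cloud
-- itself is counted, while in a cloudless column every cell is shadowed from the right.
module Submission where

open import Defs
open import Data.Nat using (ℕ; zero; suc; _+_; _∸_; _≤_; _<_; _≡ᵇ_; _<ᵇ_; z≤n; s≤s)
open import Data.Nat.Properties
open import Data.Integer using (+_; _-_)
open import Data.Integer.Properties using ([+m]-[+n]≡m⊖n; ⊖-≥)
open import Data.Bool using (Bool; true; false; T; T?; _∧_; _∨_; not)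
open import Data.Bool.Properties using (T-∧; T-≡; T-not-≡; ∧-identityʳ; ∧-zeroʳ)
open import Data.Bool.ListAction using (any)
open import Data.List using (List; []; _∷_; map; foldl)
open import Data.List.Relation.Unary.Any using (here; there)
open import Data.List.Relation.Unary.Any.Properties using (any⁺; any⁻)
open import Data.List.Relation.Unary.All as All using (All; []; _∷_)
open import Data.List.Relation.Unary.All.Properties using () renaming (map⁺ to All-map⁺)
open import Data.List.Relation.Unary.AllPairs using (AllPairs; []; _∷_)
open import Data.List.Relation.Unary.AllPairs.Properties using () renaming (map⁺ to AllPairs-map⁺)
open import Data.List.Relation.Unary.Unique.Propositional using (Unique)
import Data.List.Relation.Unary.Unique.Propositional.Properties as Unique
open import Data.List.Membership.Propositional using (_∈_; _∉_; find; lose)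
open import Data.List.Membership.Propositional.Properties using (∈-map⁺; ∈-map⁻; ∈-upTo⁺; ∈-upTo⁻)
open import Data.Maybe using (just; nothing)
open import Data.Product using (_×_; _,_; proj₁; proj₂; ∃-syntax; swap)
open import Data.Product.Properties using (≡-dec)
open import Data.List.Membership.DecPropositional (≡-dec _≟_ _≟_) using (_∈?_)
open import Data.Sum using (_⊎_; inj₁; inj₂)
open import Data.Empty using (⊥-elim)
open import Data.Fin using (Fin; toℕ; fromℕ<)
open import Data.Fin.Properties using (toℕ<n; toℕ-fromℕ<)
open import Data.Fin.Permutation using (Permutation′; _⟨$⟩ʳ_; _⟨$⟩ˡ_; inverseˡ; inverseʳ)
open import Function using (_∘_; _on_; _⇔_; mk⇔; Equivalence)
open import Function.Construct.Symmetry using (⇔-sym)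
open import Relation.Binary.Definitions using (tri<; tri≈; tri>)
open import Relation.Nullary using (¬_; contradiction; yes; no)
open import Relation.Binary.PropositionalEquality

open Equivalence using (to; from)

private
  variable
    A B : Set
    p q : A → Bool
    x : A
    xs : List A

T-injective : ∀ {a b} → (T a → T b) → (T b → T a) → a ≡ b
T-injective {false} {false} _   _   = refl
T-injective {false} {true}  _   b⇒a = ⊥-elim (b⇒a _)
T-injective {true}  {false} a⇒b _   = ⊥-elim (a⇒b _)
T-injective {true}  {true}  _   _   = refl

¬T⇒≡false : ∀ {b} → ¬ T b → b ≡ false
¬T⇒≡false {false} _  = refl
¬T⇒≡false {true}  ¬t = ⊥-elim (¬t _)

∨-as-disjoint : ∀ a b → a ∨ b ≡ (a ∧ not b) ∨ b
∨-as-disjoint false false = refl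
∨-as-disjoint false true  = refl
∨-as-disjoint true  false = refl
∨-as-disjoint true  true  = refl

<ᵇ-split : ∀ k y → (k <ᵇ y) ≡ (y ≡ᵇ suc k) ∨ (suc k <ᵇ y)
<ᵇ-split zero    zero          = refl
<ᵇ-split zero    (suc zero)    = refl
<ᵇ-split zero    (suc (suc y)) = refl
<ᵇ-split (suc k) zero          = refl
<ᵇ-split (suc k) (suc y)       = <ᵇ-split k y

count-cong : (∀ x → p x ≡ q x) → count p xs ≡ count q xs
count-cong {xs = []}     p≗q = refl
count-cong {xs = x ∷ xs} p≗q rewrite p≗q x | count-cong {xs = xs} p≗q = refl

count-∨ : (∀ x → T (p x) → ¬ T (q x)) →
  count (λ x → p x ∨ q x) xs ≡ count p xs + count q xs
count-∨ {xs = []} _ = refl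
count-∨ {p = p} {q = q} {xs = x ∷ xs} disjoint with p x in px | q x in qx
... | true  | true  = contradiction (T-≡ .from qx) (disjoint x (T-≡ .from px))
... | true  | false = cong suc (count-∨ {xs = xs} disjoint)
... | false | true  = trans (cong suc (count-∨ {xs = xs} disjoint)) (sym (+-suc _ _))
... | false | false = count-∨ {xs = xs} disjoint

count-≡0 : (∀ {x} → x ∈ xs → ¬ T (p x)) → count p xs ≡ 0
count-≡0 {xs = []} _ = refl
count-≡0 {xs = x ∷ xs} {p = p} none with p x in px
... | true  = contradiction (T-≡ .from px) (none (here refl))
... | false = count-≡0 (none ∘ there)

count-pos : x ∈ xs → T (p x) → 1 ≤ count p xs
count-pos {xs = y ∷ xs} {p = p} x∈xs px with p y in py
... | true = s≤s z≤n
count-pos (here refl)  px | false = ⊥-elim (subst T py px)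
count-pos (there x∈xs) px | false = count-pos x∈xs px

count-≡1 : ∀ {f : A → B} → AllPairs (λ x y → f x ≢ f y) xs → x ∈ xs →
  (∀ y → T (p y) ⇔ f y ≡ f x) → count p xs ≡ 1
count-≡1 {xs = y ∷ xs} {p = p} (fy∉ ∷ _) (here refl) p⇔ with p y in py
... | true  = cong suc (count-≡0 λ z∈xs pz → All.lookup fy∉ z∈xs (sym (p⇔ _ .to pz)))
... | false = ⊥-elim (subst T py (p⇔ y .from refl))
count-≡1 {xs = y ∷ xs} {p = p} (fy∉ ∷ distinct) (there x∈xs) p⇔ with p y in py
... | true  = contradiction (p⇔ y .to (T-≡ .from py)) (All.lookup fy∉ x∈xs)
... | false = count-≡1 distinct x∈xs p⇔

count-fibres : ∀ {key : A → ℕ} {ks : List ℕ} → Unique ks →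
  AllPairs (λ x y → key x ≢ key y) xs → All (λ x → key x ∈ ks) xs →
  count (λ k → any (λ x → (key x ≡ᵇ k) ∧ q x) xs) ks ≡ count q xs
count-fibres {xs = []} {ks = ks} _ _ _ = count-≡0 {xs = ks} λ _ ()
count-fibres {xs = x ∷ xs} {q = q} {key = key} {ks = ks} ks! (kx∉ ∷ distinct) (kx∈ks ∷ keys∈ks) =
  begin
    count (λ k → ((key x ≡ᵇ k) ∧ q x) ∨ any (λ y → (key y ≡ᵇ k) ∧ q y) xs) ks
  ≡⟨ count-∨ {xs = ks} disjoint ⟩
    count (λ k → (key x ≡ᵇ k) ∧ q x) ks + count (λ k → any (λ y → (key y ≡ᵇ k) ∧ q y) xs) ks
  ≡⟨ cong (λ m → count (λ k → (key x ≡ᵇ k) ∧ q x) ks + m) (count-fibres ks! distinct keys∈ks) ⟩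
    count (λ k → (key x ≡ᵇ k) ∧ q x) ks + count q xs
  ≡⟨ fibre ⟩
    count q (x ∷ xs)
  ∎
  where
  open ≡-Reasoning
  disjoint : ∀ k → T ((key x ≡ᵇ k) ∧ q x) → ¬ T (any (λ y → (key y ≡ᵇ k) ∧ q y) xs)
  disjoint k hx hxs with find (any⁻ _ xs hxs)
  ... | y , y∈xs , hy = All.lookup kx∉ y∈xs
    (trans (≡ᵇ⇒≡ (key x) k (proj₁ (T-∧ .to hx))) (sym (≡ᵇ⇒≡ (key y) k (proj₁ (T-∧ .to hy)))))
  fibre : count (λ k → (key x ≡ᵇ k) ∧ q x) ks + count q xs ≡ count q (x ∷ xs)
  fibre with q x
  ... | true  = cong (_+ count q xs) (trans (count-cong {xs = ks} (λ k → ∧-identityʳ _))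
                  (count-≡1 ks! kx∈ks λ k → mk⇔ (sym ∘ ≡ᵇ⇒≡ (key x) k) (≡⇒≡ᵇ (key x) k ∘ sym)))
  ... | false = cong (_+ count q xs) (trans (count-cong {xs = ks} (λ k → ∧-zeroʳ _))
                  (count-≡0 {xs = ks} λ _ ()))

∈-range⁻ : ∀ {n x} → x ∈ range n → 1 ≤ x × x ≤ n
∈-range⁻ x∈ with ∈-map⁻ suc x∈
... | _ , y∈ , refl = s≤s z≤n , ∈-upTo⁻ y∈

range-unique : ∀ n → Unique (range n)
range-unique n = Unique.map⁺ suc-injective (Unique.upTo⁺ n)

Cell : Set
Cell = ℕ × ℕ

InBox : ℕ → Diagram → Set
InBox n D = ∀ {r c} → T (D r c) → r ∈ range n × c ∈ range n

IsTransposeOf : Diagram → Diagram → Set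
IsTransposeOf E D = ∀ r c → E r c ≡ D c r

Shadowed : List Cell → ℕ → ℕ → Set
Shadowed L r c = (∃[ c' ] c < c' × (r , c') ∈ L) ⊎ (∃[ r' ] r < r' × (r' , c) ∈ L)

Shadowed-∷ : ∀ {L r c} x → Shadowed L r c → Shadowed (x ∷ L) r c
Shadowed-∷ x (inj₁ (c' , c<c' , ∈L)) = inj₁ (c' , c<c' , there ∈L)
Shadowed-∷ x (inj₂ (r' , r<r' , ∈L)) = inj₂ (r' , r<r' , there ∈L)

Shadowed-swap : ∀ {L r c} → Shadowed L c r → Shadowed (map swap L) r c
Shadowed-swap (inj₁ (r' , r<r' , cr'∈)) = inj₂ (r' , r<r' , ∈-map⁺ swap cr'∈)
Shadowed-swap (inj₂ (c' , c<c' , c'r∈)) = inj₁ (c' , c<c' , ∈-map⁺ swap c'r∈)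

-- The invariant of the scan once the rows below row m have been processed.
record IsDarkBelow (D : Diagram) (m : ℕ) (L : List Cell) : Set where
  field
    below    : All (λ x → m < proj₁ x) L
    ⊆D       : All (λ x → T (D (proj₁ x) (proj₂ x))) L
    rows-≢   : AllPairs (_≢_ on proj₁) L
    cols-≢   : AllPairs (_≢_ on proj₂) L
    shadowed : ∀ {r c} → m < r → T (D r c) → (r , c) ∉ L → Shadowed L r c

IsDark : Diagram → List Cell → Set
IsDark D = IsDarkBelow D 0

open IsDarkBelow

distinct-on⇒≡ : ∀ {f : A → ℕ} {x y} → AllPairs (_≢_ on f) xs →
  x ∈ xs → y ∈ xs → f x ≡ f y → x ≡ y
distinct-on⇒≡ _              (here refl) (here refl) _     = refl
distinct-on⇒≡ (fx∉ ∷ _)      (here refl) (there y∈)  fx≡fy = contradiction fx≡fy (All.lookup fx∉ y∈)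
distinct-on⇒≡ (fy∉ ∷ _)      (there x∈)  (here refl) fx≡fy = contradiction (sym fx≡fy) (All.lookup fy∉ x∈)
distinct-on⇒≡ (_ ∷ distinct) (there x∈)  (there y∈)  fx≡fy = distinct-on⇒≡ distinct x∈ y∈ fx≡fy

module _ {D m L} (L-dark : IsDarkBelow D m L) where

  one-per-row : ∀ {r c c'} → (r , c) ∈ L → (r , c') ∈ L → c ≡ c'
  one-per-row rc∈ rc'∈ = cong proj₂ (distinct-on⇒≡ (rows-≢ L-dark) rc∈ rc'∈ refl)

  one-per-column : ∀ {r r' c} → (r , c) ∈ L → (r' , c) ∈ L → r ≡ r'
  one-per-column rc∈ r'c∈ = cong proj₁ (distinct-on⇒≡ (cols-≢ L-dark) rc∈ r'c∈ refl)

  ∈⇒∈D : ∀ {r c} → (r , c) ∈ L → T (D r c)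
  ∈⇒∈D = All.lookup (⊆D L-dark)

largest-just : ∀ k {p c} → largest k p ≡ just c →
  T (p c) × (∀ {c'} → c < c' → c' ≤ k → ¬ T (p c'))
largest-just (suc k) {p} eq with p (suc k) in pk
largest-just (suc k) refl | true = T-≡ .from pk , λ k<c' c'≤k → contradiction c'≤k (<⇒≱ k<c')
largest-just (suc k) {p} {c} eq | false with largest-just k {p} eq
... | pc , none-above = pc , above
  where
  above : ∀ {c'} → c < c' → c' ≤ suc k → ¬ T (p c')
  above c<c' c'≤1+k with m≤n⇒m<n∨m≡n c'≤1+k
  ... | inj₁ c'<1+k = none-above c<c' (≤-pred c'<1+k)
  ... | inj₂ refl   = subst T pk

largest-nothing : ∀ k {p} → largest k p ≡ nothing → ∀ {c} → 1 ≤ c → c ≤ k → ¬ T (p c)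
largest-nothing zero    _        1≤c c≤0 = contradiction (≤-trans 1≤c c≤0) λ ()
largest-nothing (suc k) {p} eq 1≤c c≤1+k with p (suc k) in pk | m≤n⇒m<n∨m≡n c≤1+k
... | false | inj₁ c<1+k = largest-nothing k eq 1≤c (≤-pred c<1+k)
... | false | inj₂ refl  = subst T pk

colUsed⇒∈ : ∀ {L c} → T (colUsed L c) → ∃[ r ] (r , c) ∈ L
colUsed⇒∈ {L} {c} used with find (any⁻ _ L used)
... | (r , c') , rc'∈ , c'≡c rewrite ≡ᵇ⇒≡ c' c c'≡c = r , rc'∈

¬colUsed⇒∉ : ∀ {L c} → ¬ T (colUsed L c) → All (λ x → c ≢ proj₂ x) L
¬colUsed⇒∉ {L} {c} unused = All.tabulate λ {x} x∈ c≡ →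
  unused (any⁺ _ (lose x∈ (≡⇒≡ᵇ (proj₂ x) c (sym c≡))))

-- If (r , c) ∈ L₁ were missing from L₂, the cloud of L₂ shadowing it and the cloud
-- of L₁ shadowing that one would meet (r , c) or each other in a row or a column.
row-⊆ : ∀ {D L₁ L₂ r} → IsDark D L₁ → IsDark D L₂ →
  (∀ {r' c} → r < r' → (r' , c) ∈ L₁ ⇔ (r' , c) ∈ L₂) →
  ∀ {c} → (r , c) ∈ L₁ → (r , c) ∈ L₂
row-⊆ {L₁ = L₁} {L₂} {r} L₁-dark L₂-dark same {c} rc∈L₁ with (r , c) ∈? L₂
... | yes rc∈L₂ = rc∈L₂
... | no rc∉L₂ with shadowed L₂-dark (All.lookup (below L₁-dark) rc∈L₁) (∈⇒∈D L₁-dark rc∈L₁) rc∉L₂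
...   | inj₂ (r' , r<r' , r'c∈L₂) =
  contradiction (one-per-column L₁-dark rc∈L₁ (same r<r' .from r'c∈L₂)) (<⇒≢ r<r')
...   | inj₁ (c' , c<c' , rc'∈L₂) with (r , c') ∈? L₁
...     | yes rc'∈L₁ = contradiction (one-per-row L₁-dark rc∈L₁ rc'∈L₁) (<⇒≢ c<c')
...     | no rc'∉L₁ with shadowed L₁-dark (All.lookup (below L₁-dark) rc∈L₁) (∈⇒∈D L₂-dark rc'∈L₂) rc'∉L₁
...       | inj₁ (c'' , c'<c'' , rc''∈L₁) =
  contradiction (one-per-row L₁-dark rc∈L₁ rc''∈L₁) (<⇒≢ (<-trans c<c' c'<c''))
...       | inj₂ (r'' , r<r'' , r''c'∈L₁) =
  contradiction (one-per-column L₂-dark rc'∈L₂ (same r<r'' .to r''c'∈L₁)) (<⇒≢ r<r'')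

module DarkClouds {n D} (box : InBox n D) where

  column-taken : ∀ {m L c} → IsDarkBelow D (suc m) L → T (D (suc m) c) →
    ¬ T (D (suc m) c ∧ not (colUsed L c)) → Shadowed L (suc m) c
  column-taken {L = L} {c} L-dark d free with colUsed L c in used
  ... | true  = let r , rc∈ = colUsed⇒∈ (T-≡ .from used) in inj₂ (r , All.lookup (below L-dark) rc∈ , rc∈)
  ... | false = contradiction (T-∧ .from (d , _)) free

  darkStep-below : ∀ {m L} → IsDarkBelow D (suc m) L →
    IsDarkBelow D m (darkStep n D L (suc m))
  darkStep-below {m} {L} L-dark with largest n (λ c → D (suc m) c ∧ not (colUsed L c)) in eq
  ... | nothing = record
    { below    = All.map <⇒≤ (below L-dark)
    ; ⊆D       = ⊆D L-dark
    ; rows-≢   = rows-≢ L-dark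
    ; cols-≢   = cols-≢ L-dark
    ; shadowed = shadowed′
    }
    where
    shadowed′ : ∀ {r c} → m < r → T (D r c) → (r , c) ∉ L → Shadowed L r c
    shadowed′ m<r d rc∉ with m≤n⇒m<n∨m≡n m<r
    ... | inj₁ 1+m<r = shadowed L-dark 1+m<r d rc∉
    ... | inj₂ refl with ∈-range⁻ (proj₂ (box d))
    ...   | 1≤c , c≤n = column-taken L-dark d (largest-nothing n eq 1≤c c≤n)
  ... | just c with largest-just n eq
  ...   | chosen , none-right = record
    { below    = ≤-refl ∷ All.map <⇒≤ (below L-dark)
    ; ⊆D       = proj₁ (T-∧ .to chosen) ∷ ⊆D L-dark
    ; rows-≢   = All.map <⇒≢ (below L-dark) ∷ rows-≢ L-dark
    ; cols-≢   = ¬colUsed⇒∉ (subst T (T-not-≡ .to (proj₂ (T-∧ .to chosen)))) ∷ cols-≢ L-dark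
    ; shadowed = shadowed′
    }
    where
    shadowed′ : ∀ {r c₀} → m < r → T (D r c₀) → (r , c₀) ∉ (suc m , c) ∷ L →
      Shadowed ((suc m , c) ∷ L) r c₀
    shadowed′ m<r d rc∉ with m≤n⇒m<n∨m≡n m<r
    ... | inj₁ 1+m<r = Shadowed-∷ _ (shadowed L-dark 1+m<r d (rc∉ ∘ there))
    ... | inj₂ refl with <-cmp _ c
    ...   | tri< c₀<c _ _ = inj₁ (c , c₀<c , here refl)
    ...   | tri≈ _ refl _ = contradiction (here refl) rc∉
    ...   | tri> _ _ c<c₀ =
      Shadowed-∷ _ (column-taken L-dark d (none-right c<c₀ (proj₂ (∈-range⁻ (proj₂ (box d))))))

  scan-isDark : ∀ m {L} → IsDarkBelow D m L →
    IsDark D (foldl (darkStep n D) L (rowsBottomUp m))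
  scan-isDark zero    L-dark = L-dark
  scan-isDark (suc m) L-dark = scan-isDark m (darkStep-below L-dark)

  dark-isDark : IsDark D (dark n D)
  dark-isDark = scan-isDark n record
    { below = [] ; ⊆D = [] ; rows-≢ = [] ; cols-≢ = []
    ; shadowed = λ n<r d _ → contradiction (proj₂ (∈-range⁻ (proj₁ (box d)))) (<⇒≱ n<r)
    }

  ∈-box : ∀ {m L r c} → IsDarkBelow D m L → (r , c) ∈ L → r ∈ range n × c ∈ range n
  ∈-box L-dark = box ∘ ∈⇒∈D L-dark

  isDark-unique : ∀ {L₁ L₂} → IsDark D L₁ → IsDark D L₂ → ∀ {r c} → (r , c) ∈ L₁ ⇔ (r , c) ∈ L₂
  isDark-unique {L₁} {L₂} L₁-dark L₂-dark {r} = agree (suc n) (m≤m+n (suc n) r)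
    where
    agree : ∀ k {r} → n < k + r → ∀ {c} → (r , c) ∈ L₁ ⇔ (r , c) ∈ L₂
    agree zero {r} n<r = mk⇔ (outside L₁-dark) (outside L₂-dark)
      where
      outside : ∀ {L L′ c} → IsDark D L → (r , c) ∈ L → (r , c) ∈ L′
      outside L-dark rc∈ = contradiction (proj₂ (∈-range⁻ (proj₁ (∈-box L-dark rc∈)))) (<⇒≱ n<r)
    agree (suc k) {r} n<1+k+r =
      mk⇔ (row-⊆ L₁-dark L₂-dark same) (row-⊆ L₂-dark L₁-dark (⇔-sym ∘ same))
      where
      same : ∀ {r' c} → r < r' → (r' , c) ∈ L₁ ⇔ (r' , c) ∈ L₂
      same r<r' = agree k (≤-<-trans (≤-pred n<1+k+r) (+-monoʳ-< k r<r'))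

∈-map-swap⁻ : ∀ {L : List Cell} {r c} → (r , c) ∈ map swap L → (c , r) ∈ L
∈-map-swap⁻ rc∈ with ∈-map⁻ swap rc∈
... | _ , cr∈ , refl = cr∈

module _ {n D E} (box : InBox n D) (Eᵀ : IsTransposeOf E D) where

  InBox-ᵀ : InBox n E
  InBox-ᵀ {r} {c} e = swap (box (subst T (Eᵀ r c) e))

  IsDark-ᵀ : ∀ {L} → IsDark D L → IsDark E (map swap L)
  IsDark-ᵀ {L} L-dark = record
    { below    = All-map⁺ (All.map (proj₁ ∘ ∈-range⁻ ∘ proj₂ ∘ box) (⊆D L-dark))
    ; ⊆D       = All-map⁺ (All.map (subst T (sym (Eᵀ _ _))) (⊆D L-dark))
    ; rows-≢   = AllPairs-map⁺ (cols-≢ L-dark)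
    ; cols-≢   = AllPairs-map⁺ (rows-≢ L-dark)
    ; shadowed = λ {r} {c} _ e rc∉ → let d = subst T (Eᵀ r c) e in
        Shadowed-swap (shadowed L-dark (proj₁ (∈-range⁻ (proj₁ (box d)))) d (rc∉ ∘ ∈-map⁺ swap))
    }

  dark-ᵀ : ∀ {r c} → (r , c) ∈ dark n E ⇔ (c , r) ∈ dark n D
  dark-ᵀ = mk⇔ (∈-map-swap⁻ ∘ same .to) (same .from ∘ ∈-map⁺ swap)
    where
    same : ∀ {r c} → (r , c) ∈ dark n E ⇔ (r , c) ∈ map swap (dark n D)
    same = DarkClouds.isDark-unique InBox-ᵀ (DarkClouds.dark-isDark InBox-ᵀ)
             (IsDark-ᵀ (DarkClouds.dark-isDark box))

any-swap : ∀ {L₁ L₂ : List Cell} (p : Cell → Bool) →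
  (∀ {r c} → (r , c) ∈ L₁ ⇔ (c , r) ∈ L₂) → any p L₁ ≡ any (p ∘ swap) L₂
any-swap {L₁} {L₂} p L₁⇔L₂ = T-injective
  (λ t → let _ , rc∈ , prc = find (any⁻ p L₁ t) in any⁺ (p ∘ swap) (lose (L₁⇔L₂ .to rc∈) prc))
  (λ t → let _ , cr∈ , prc = find (any⁻ (p ∘ swap) L₂ t) in any⁺ p (lose (L₁⇔L₂ .from cr∈) prc))

-- For D = Rothe(w), moveCount is movecode(w) and cloudsRightOf is d(w).
module Codes {n D} (box : InBox n D) where

  open DarkClouds box

  clouds : List Cell
  clouds = dark n D

  cloudRightOf : ℕ → ℕ → Bool
  cloudRightOf k r = any (λ x → (proj₁ x ≡ᵇ r) ∧ (k <ᵇ proj₂ x)) clouds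

  moveCount : ℕ → ℕ
  moveCount k = count (λ r → D r k ∧ not (cloudRightOf k r)) (range n)

  cloudsRightOf : ℕ → ℕ
  cloudsRightOf k = count (λ x → k <ᵇ proj₂ x) clouds

  cloudsIn : ℕ → ℕ
  cloudsIn k = count (λ x → proj₂ x ≡ᵇ k) clouds

  private
    clouds-dark : IsDark D clouds
    clouds-dark = dark-isDark

  cloudsRightOf-suc : ∀ k → cloudsRightOf k ≡ cloudsIn (suc k) + cloudsRightOf (suc k)
  cloudsRightOf-suc k = trans (count-cong {xs = clouds} (λ x → <ᵇ-split k (proj₂ x)))
    (count-∨ {xs = clouds} λ (_ , y) y≡1+k 1+k<y →
      <-irrefl (sym (≡ᵇ⇒≡ y (suc k) y≡1+k)) (<ᵇ⇒< (suc k) y 1+k<y))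

  ¬cloudRightOf : ∀ {r k} → (r , k) ∈ clouds → ¬ T (cloudRightOf k r)
  ¬cloudRightOf {r} {k} rk∈ t with find (any⁻ _ clouds t)
  ... | (r' , c') , r'c'∈ , hit with T-∧ .to hit
  ...   | r'≡r , k<c' with ≡ᵇ⇒≡ r' r r'≡r
  ...     | refl = <-irrefl (one-per-row clouds-dark rk∈ r'c'∈) (<ᵇ⇒< k c' k<c')

  column-with-cloud : ∀ {r k} → (r , k) ∈ clouds → cloudsIn k ≡ 1 × 1 ≤ moveCount k
  column-with-cloud {r} {k} rk∈ =
      count-≡1 (cols-≢ clouds-dark) rk∈ (λ (_ , c) → mk⇔ (≡ᵇ⇒≡ c k) (≡⇒≡ᵇ c k))
    , count-pos (proj₁ (∈-box clouds-dark rk∈))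
        (T-∧ .from (∈⇒∈D clouds-dark rk∈ , T-not-≡ .from (¬T⇒≡false (¬cloudRightOf rk∈))))

  column-without-cloud : ∀ {k} → ¬ T (colUsed clouds k) → cloudsIn k ≡ 0 × moveCount k ≡ 0
  column-without-cloud {k} free =
      count-≡0 {xs = clouds} (λ x∈ hit → free (any⁺ _ (lose x∈ hit)))
    , count-≡0 {xs = range n} unmoved
    where
    cloud∉ : ∀ {r} → (r , k) ∉ clouds
    cloud∉ rk∈ = free (any⁺ _ (lose rk∈ (≡⇒≡ᵇ k k refl)))
    unmoved : ∀ {r} → r ∈ range n → ¬ T (D r k ∧ not (cloudRightOf k r))
    unmoved {r} r∈ t with T-∧ .to t
    ... | d , unshadowed with shadowed clouds-dark (proj₁ (∈-range⁻ r∈)) d cloud∉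
    ...   | inj₁ (c' , k<c' , rc'∈) = subst T (T-not-≡ .to unshadowed)
      (any⁺ _ (lose rc'∈ (T-∧ .from (≡⇒≡ᵇ r r refl , <⇒<ᵇ k<c'))))
    ...   | inj₂ (_ , _ , r'k∈) = cloud∉ r'k∈

  moveCount∸1+cloudsIn : ∀ k → moveCount k ∸ 1 + cloudsIn k ≡ moveCount k
  moveCount∸1+cloudsIn k with T? (colUsed clouds k)
  ... | yes used with column-with-cloud (proj₂ (colUsed⇒∈ used))
  ...   | one , positive rewrite one = m∸n+n≡m positive
  moveCount∸1+cloudsIn k | no free with column-without-cloud free
  ...   | none , unmoved rewrite none | unmoved = refl

  -- The left-hand side is the number of cells in row k of the snow diagram of E.
  snowRow-ᵀ : ∀ {E} → IsTransposeOf E D → ∀ k →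
    count (λ c → E k c ∨ any (λ x → (proj₂ x ≡ᵇ c) ∧ (k <ᵇ proj₁ x)) (dark n E)) (range n)
      ≡ moveCount k + cloudsRightOf k
  snowRow-ᵀ {E} Eᵀ k = begin
      count (λ c → E k c ∨ any (λ x → (proj₂ x ≡ᵇ c) ∧ (k <ᵇ proj₁ x)) (dark n E)) (range n)
    ≡⟨ count-cong {xs = range n} (λ c →
         trans (cong₂ _∨_ (Eᵀ k c) (any-swap _ (dark-ᵀ box Eᵀ)))
               (∨-as-disjoint (D c k) (cloudRightOf k c))) ⟩
      count (λ c → (D c k ∧ not (cloudRightOf k c)) ∨ cloudRightOf k c) (range n)
    ≡⟨ count-∨ {xs = range n} (λ _ t → subst T (T-not-≡ .to (proj₂ (T-∧ .to t)))) ⟩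
      moveCount k + count (cloudRightOf k) (range n)
    ≡⟨ cong (λ m → moveCount k + m) (count-fibres {q = λ x → k <ᵇ proj₂ x}
         (range-unique n) (rows-≢ clouds-dark) (All.map (proj₁ ∘ box) (⊆D clouds-dark))) ⟩
      moveCount k + cloudsRightOf k
    ∎
    where open ≡-Reasoning

record InverseOn (n : ℕ) (v u : ℕ → ℕ) : Set where
  field
    v-range : ∀ {i} → i ∈ range n → v i ∈ range n
    u-range : ∀ {i} → i ∈ range n → u i ∈ range n
    u∘v     : ∀ {i} → i ∈ range n → u (v i) ≡ i
    v∘u     : ∀ {i} → i ∈ range n → v (u i) ≡ i

  flip : InverseOn n u v
  flip = record { v-range = u-range ; u-range = v-range ; u∘v = v∘u ; v∘u = u∘v }

-- The witness j of a Rothe cell (r , c) = (r , v j) is forced to be u c.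
rothe⇔ : ∀ {n v u} → InverseOn n v u →
  ∀ {r c} → T (rothe n v r c) ⇔ (r ∈ range n × c ∈ range n × r < u c × c < v r)
rothe⇔ {n} {v} {u} inv {r} {c} = mk⇔ ⇒ ⇐
  where
  open InverseOn inv
  ⇒ : T (rothe n v r c) → r ∈ range n × c ∈ range n × r < u c × c < v r
  ⇒ t with find (any⁻ _ (range n) t)
  ... | i , i∈ , hit with T-∧ .to hit
  ...   | i≡r , t′ with ≡ᵇ⇒≡ i r i≡r | find (any⁻ _ (range n) t′)
  ...     | refl | j , j∈ , hit′ with T-∧ .to hit′
  ...       | i<j , t″ with T-∧ .to t″
  ...         | vj<vi , vj≡c with ≡ᵇ⇒≡ (v j) c vj≡c
  ...           | refl = i∈ , v-range j∈ , subst (i <_) (sym (u∘v j∈)) (<ᵇ⇒< i j i<j) , <ᵇ⇒< _ _ vj<vi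
  ⇐ : r ∈ range n × c ∈ range n × r < u c × c < v r → T (rothe n v r c)
  ⇐ (r∈ , c∈ , r<uc , c<vr) = any⁺ _ (lose r∈ (T-∧ .from (≡⇒≡ᵇ r r refl ,
    any⁺ _ (lose (u-range c∈) (T-∧ .from (<⇒<ᵇ r<uc ,
      T-∧ .from (<⇒<ᵇ (subst (_< v r) (sym (v∘u c∈)) c<vr) , ≡⇒≡ᵇ _ c (v∘u c∈))))))))

module _ {n v u} (inv : InverseOn n v u) where

  rothe-inBox : InBox n (rothe n v)
  rothe-inBox t = let r∈ , c∈ , _ = rothe⇔ inv .to t in r∈ , c∈

  rothe-inverse : IsTransposeOf (rothe n u) (rothe n v)
  rothe-inverse r c = T-injective
    (λ t → let r∈ , c∈ , r<vc , c<ur = rothe⇔ (InverseOn.flip inv) .to t in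
           rothe⇔ inv .from (c∈ , r∈ , c<ur , r<vc))
    (λ t → let c∈ , r∈ , c<ur , r<vc = rothe⇔ inv .to t in
           rothe⇔ (InverseOn.flip inv) .from (r∈ , c∈ , r<vc , c<ur))

toFin-suc-toℕ : ∀ {n} (k : Fin n) → toFin n (suc (toℕ k)) ≡ just k
toFin-suc-toℕ {suc n} Fin.zero    = refl
toFin-suc-toℕ {suc n} (Fin.suc k) rewrite toFin-suc-toℕ k = refl

range-elim : ∀ {n} (P : ℕ → Set) → (∀ (k : Fin n) → P (suc (toℕ k))) → ∀ {i} → i ∈ range n → P i
range-elim P f i∈ with ∈-map⁻ suc i∈
... | j , j∈ , refl = subst (P ∘ suc) (toℕ-fromℕ< j<n) (f (fromℕ< j<n))
  where j<n = ∈-upTo⁻ j∈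

suc-toℕ∈range : ∀ {n} (k : Fin n) → suc (toℕ k) ∈ range n
suc-toℕ∈range k = ∈-map⁺ suc (∈-upTo⁺ (toℕ<n k))

module _ {n} (π : Permutation′ n) where

  permFun-suc-toℕ : ∀ k → permFun π (suc (toℕ k)) ≡ suc (toℕ (π ⟨$⟩ʳ k))
  permFun-suc-toℕ k rewrite toFin-suc-toℕ k = refl

  permInvFun-suc-toℕ : ∀ k → permInvFun π (suc (toℕ k)) ≡ suc (toℕ (π ⟨$⟩ˡ k))
  permInvFun-suc-toℕ k rewrite toFin-suc-toℕ k = refl

  permFun-inverseOn : InverseOn n (permFun π) (permInvFun π)
  permFun-inverseOn = record
    { v-range = range-elim (λ i → permFun π i ∈ range n) λ k →
        subst (_∈ range n) (sym (permFun-suc-toℕ k)) (suc-toℕ∈range _)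
    ; u-range = range-elim (λ i → permInvFun π i ∈ range n) λ k →
        subst (_∈ range n) (sym (permInvFun-suc-toℕ k)) (suc-toℕ∈range _)
    ; u∘v     = range-elim (λ i → permInvFun π (permFun π i) ≡ i) λ k → begin
        permInvFun π (permFun π (suc (toℕ k)))  ≡⟨ cong (permInvFun π) (permFun-suc-toℕ k) ⟩
        permInvFun π (suc (toℕ (π ⟨$⟩ʳ k)))     ≡⟨ permInvFun-suc-toℕ _ ⟩
        suc (toℕ (π ⟨$⟩ˡ (π ⟨$⟩ʳ k)))           ≡⟨ cong (suc ∘ toℕ) (inverseˡ π) ⟩
        suc (toℕ k)                             ∎
    ; v∘u     = range-elim (λ i → permFun π (permInvFun π i) ≡ i) λ k → begin
        permFun π (permInvFun π (suc (toℕ k)))  ≡⟨ cong (permFun π) (permInvFun-suc-toℕ k) ⟩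
        permFun π (suc (toℕ (π ⟨$⟩ˡ k)))        ≡⟨ permFun-suc-toℕ _ ⟩
        suc (toℕ (π ⟨$⟩ʳ (π ⟨$⟩ˡ k)))           ≡⟨ cong (suc ∘ toℕ) (inverseʳ π) ⟩
        suc (toℕ k)                             ∎
    }
    where open ≡-Reasoning

module _ {n} (w : Permutation′ n) where
  private
    inv = permFun-inverseOn w
    open Codes (rothe-inBox inv)

  rajcodeInv≡movecode+dcount : ∀ i → rajcodeInv w (suc i) ≡ movecode w (suc i) + dcount w (suc i)
  rajcodeInv≡movecode+dcount i = snowRow-ᵀ (rothe-inverse inv) (suc i)

  rajcodeInv≡movecode∸1+dcount : ∀ i → rajcodeInv w (suc i) ≡ (movecode w (suc i) ∸ 1) + dcount w i
  rajcodeInv≡movecode∸1+dcount i = begin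
    rajcodeInv w (suc i)
      ≡⟨ rajcodeInv≡movecode+dcount i ⟩
    movecode w (suc i) + dcount w (suc i)
      ≡⟨ cong (_+ dcount w (suc i)) (moveCount∸1+cloudsIn (suc i)) ⟨
    (movecode w (suc i) ∸ 1) + cloudsIn (suc i) + dcount w (suc i)
      ≡⟨ +-assoc (movecode w (suc i) ∸ 1) (cloudsIn (suc i)) (dcount w (suc i)) ⟩
    (movecode w (suc i) ∸ 1) + (cloudsIn (suc i) + dcount w (suc i))
      ≡⟨ cong (λ d → (movecode w (suc i) ∸ 1) + d) (cloudsRightOf-suc i) ⟨
    (movecode w (suc i) ∸ 1) + dcount w i
      ∎
    where open ≡-Reasoning

[+m+n]-[+m]≡+n : ∀ m n → + (m + n) - + m ≡ + n
[+m+n]-[+m]≡+n m n =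
  trans ([+m]-[+n]≡m⊖n (m + n) m) (trans (⊖-≥ (m≤m+n m n)) (cong +_ (m+n∸m≡n m n)))

proposition4p3 : ∀ (n : ℕ) (w : Permutation′ n) (c : ℕ) → 1 ≤ c → c ≤ n →
    ((+ rajcodeInv w (suc c)) - (+ (movecode w (suc c) ∸ 1)) ≡ + dcount w c)
    × (+ dcount w c ≡ (+ rajcodeInv w c) - (+ movecode w c))
proposition4p3 n w (suc c) _ _ =
    trans (cong (λ m → + m - + (movecode w (suc (suc c)) ∸ 1)) (rajcodeInv≡movecode∸1+dcount w (suc c)))
          ([+m+n]-[+m]≡+n (movecode w (suc (suc c)) ∸ 1) (dcount w (suc c)))
  , sym (trans (cong (λ m → + m - + movecode w (suc c)) (rajcodeInv≡movecode+dcount w c))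
               ([+m+n]-[+m]≡+n (movecode w (suc c)) (dcount w (suc c))))
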